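{- Let $(\mathfrak{Q},\&,e)$ be a unital quantale and $p,q\in\mathfrak{Q}$. Then: (1) $\mathcal{D}\mathfrak{Q}(\bot,q)=\mathcal{D}\mathfrak{Q}(q,\bot)=\{\bot\}$; (2) $\mathcal{D}\mathfrak{Q}(e,e)=\mathfrak{Q}$; (3) $q\in\mathcal{D}\mathfrak{Q}(q,q)$; (4) $\bot\in\mathcal{D}\mathfrak{Q}(p,q)$; (5) $e\in\mathcal{D}\mathfrak{Q}(\top,\top)$ if and only if $\mathfrak{Q}$ is integral. Moreover, (6) $\mathfrak{Q}$ is integral if and only if $\mathcal{D}\mathfrak{Q}(p,q)\subseteq\{u\in\mathfrak{Q}: u\le p\wedge q\}$ for all $p,q\in\mathfrak{Q}$; and (7) $\mathfrak{Q}$ is divisible if and only if $\mathcal{D}\mathfrak{Q}(p,q)=\{u\in\mathfrak{Q}: u\le p\wedge q\}$ for all $p,q\in\mathfrak{Q}$.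
   Context: A unital quantale $(\mathfrak{Q},\&,e)$ is a complete lattice with an associative multiplication $\&$ with unit $e$, distributing over arbitrary joins in each variable; throughout it is assumed non-trivial ($\bot<e$). Implications are defined by $p\& q\le r\iff p\le r/q\iff q\le p\backslash r$. $\mathcal{D}\mathfrak{Q}(p,q)=\{u\in\mathfrak{Q}: (u/p)\& p=u=q\&(q\backslash u)\}$. $\mathfrak{Q}$ is integral if $e=\top$; $\mathfrak{Q}$ is divisible if whenever $u\le q$ one has $q\&(q\backslash u)=u=(u/q)\& q$. -}

module Defs where

open import Level using (Level; suc; _⊔_; Lift)
open import Data.Empty using (⊥)
open import Data.Product using (Σ; _×_; proj₁)
open import Relation.Binary.PropositionalEquality using (_≡_; _≢_)

record UnitalQuantale (c : Level) : Set (suc c) where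
  infixl 7 _&_
  infix 4 _≤_
  field
    Carrier   : Set c
    _≤_       : Carrier → Carrier → Set c
    ≤-refl    : ∀ {x} → x ≤ x
    ≤-trans   : ∀ {x y z} → x ≤ y → y ≤ z → x ≤ z
    ≤-antisym : ∀ {x y} → x ≤ y → y ≤ x → x ≡ y
    ⋁         : {I : Set c} → (I → Carrier) → Carrier
    ⋁-upper   : ∀ {I : Set c} (f : I → Carrier) (i : I) → f i ≤ ⋁ f
    ⋁-least   : ∀ {I : Set c} (f : I → Carrier) (z : Carrier) →
                (∀ i → f i ≤ z) → ⋁ f ≤ z
    _&_       : Carrier → Carrier → Carrier
    e         : Carrier
    &-assoc   : ∀ x y z → (x & y) & z ≡ x & (y & z)
    &-identityˡ : ∀ x → e & x ≡ x
    &-identityʳ : ∀ x → x & e ≡ x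
    &-distribˡ-⋁ : ∀ (a : Carrier) {I : Set c} (f : I → Carrier) →
                   a & ⋁ f ≡ ⋁ (λ i → a & f i)
    &-distribʳ-⋁ : ∀ (a : Carrier) {I : Set c} (f : I → Carrier) →
                   ⋁ f & a ≡ ⋁ (λ i → f i & a)

  ⊥q : Carrier
  ⊥q = ⋁ {Lift c ⊥} (λ ())

  ⊤q : Carrier
  ⊤q = ⋁ {Carrier} (λ x → x)

  _∧_ : Carrier → Carrier → Carrier
  p ∧ q = ⋁ {Σ Carrier (λ x → (x ≤ p) × (x ≤ q))} proj₁

  -- implications:  p & q ≤ r  iff  p ≤ r / q  iff  q ≤ p \ r
  _/_ : Carrier → Carrier → Carrier
  r / q = ⋁ {Σ Carrier (λ x → x & q ≤ r)} proj₁

  _╲_ : Carrier → Carrier → Carrier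
  p ╲ r = ⋁ {Σ Carrier (λ x → p & x ≤ r)} proj₁

  𝒟 : Carrier → Carrier → Carrier → Set c
  𝒟 p q u = ((u / p) & p ≡ u) × (q & (q ╲ u) ≡ u)

  Integral : Set c
  Integral = e ≡ ⊤q

  Divisible : Set c
  Divisible = ∀ u q → u ≤ q → (q & (q ╲ u) ≡ u) × ((u / q) & q ≡ u)

NonTrivial : ∀ {c} → UnitalQuantale c → Set c
NonTrivial Q = (⊥q ≤ e) × (⊥q ≢ e)
  where open UnitalQuantale Q

-- Since (u / p) & p ≤ u always, u ∈ 𝒟(p,q) as soon as u = x & p and
-- u = q & y for some x, y: this yields (2)–(4), and under divisibility
-- every u ≤ p ∧ q.  Conversely such factorisations bound u by ⊤ & p and
-- q & ⊤, which collapse to p and q when e = ⊤, and they vanish when p or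
-- q is ⊥.  Integrality comes back from e ∈ 𝒟(⊤,⊤): ⊤ & ⊤ ≤ ⊤ gives
-- ⊤ = e & ⊤ = ((e / ⊤) & ⊤) & ⊤ ≤ (e / ⊤) & ⊤ = e.
module Submission where

open import Defs
open import Level using (Level)
open import Data.Product using (Σ; _×_; _,_; proj₁; proj₂; swap)
open import Function.Bundles using (_⇔_; mk⇔; Equivalence)
open import Relation.Binary.Bundles using (Poset)
open import Relation.Binary.PropositionalEquality
  using (_≡_; refl; sym; trans; cong; subst; isEquivalence)
import Relation.Binary.Reasoning.PartialOrder as PosetReasoning

module QuantaleProperties {c : Level} (Q : UnitalQuantale c) where
  open UnitalQuantale Q

  ≤-reflexive : ∀ {x y} → x ≡ y → x ≤ y
  ≤-reflexive refl = ≤-refl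

  ≤-poset : Poset c c c
  ≤-poset = record
    { Carrier = Carrier
    ; _≈_ = _≡_
    ; _≤_ = _≤_
    ; isPartialOrder = record
      { isPreorder = record
        { isEquivalence = isEquivalence
        ; reflexive = ≤-reflexive
        ; trans = ≤-trans
        }
      ; antisym = ≤-antisym
      }
    }

  open PosetReasoning ≤-poset

  ⊥q-minimum : ∀ x → ⊥q ≤ x
  ⊥q-minimum x = ⋁-least _ x (λ ())

  ⊤q-maximum : ∀ x → x ≤ ⊤q
  ⊤q-maximum x = ⋁-upper (λ y → y) x

  ⋁-downset : ∀ y → ⋁ {Σ Carrier (_≤ y)} proj₁ ≡ y
  ⋁-downset y = ≤-antisym (⋁-least proj₁ y proj₂) (⋁-upper proj₁ (y , ≤-refl))

  ⋁-&-least : ∀ {I : Set c} (f : I → Carrier) a z →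
              (∀ i → f i & a ≤ z) → ⋁ f & a ≤ z
  ⋁-&-least f a z bound = subst (_≤ z) (sym (&-distribʳ-⋁ a f)) (⋁-least _ z bound)

  &-⋁-least : ∀ {I : Set c} (f : I → Carrier) a z →
              (∀ i → a & f i ≤ z) → a & ⋁ f ≤ z
  &-⋁-least f a z bound = subst (_≤ z) (sym (&-distribˡ-⋁ a f)) (⋁-least _ z bound)

  &-monoˡ-≤ : ∀ {x y} z → x ≤ y → x & z ≤ y & z
  &-monoˡ-≤ {x} {y} z x≤y = begin
    x & z                          ≤⟨ ⋁-upper (λ i → proj₁ i & z) (x , x≤y) ⟩
    ⋁ (λ i → proj₁ i & z)          ≡⟨ sym (&-distribʳ-⋁ z proj₁) ⟩
    ⋁ {Σ Carrier (_≤ y)} proj₁ & z ≡⟨ cong (_& z) (⋁-downset y) ⟩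
    y & z                          ∎

  &-monoʳ-≤ : ∀ {x y} z → x ≤ y → z & x ≤ z & y
  &-monoʳ-≤ {x} {y} z x≤y = begin
    z & x                          ≤⟨ ⋁-upper (λ i → z & proj₁ i) (x , x≤y) ⟩
    ⋁ (λ i → z & proj₁ i)          ≡⟨ sym (&-distribˡ-⋁ z proj₁) ⟩
    z & ⋁ {Σ Carrier (_≤ y)} proj₁ ≡⟨ cong (z &_) (⋁-downset y) ⟩
    z & y                          ∎

  &-zeroˡ : ∀ x → ⊥q & x ≡ ⊥q
  &-zeroˡ x = ≤-antisym (⋁-&-least _ x ⊥q (λ ())) (⊥q-minimum _)

  &-zeroʳ : ∀ x → x & ⊥q ≡ ⊥q
  &-zeroʳ x = ≤-antisym (&-⋁-least _ x ⊥q (λ ())) (⊥q-minimum _)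

  /-intro : ∀ {x q r} → x & q ≤ r → x ≤ r / q
  /-intro {x} x&q≤r = ⋁-upper proj₁ (x , x&q≤r)

  /-elim : ∀ r q → (r / q) & q ≤ r
  /-elim r q = ⋁-&-least proj₁ q r proj₂

  ╲-intro : ∀ {x p r} → p & x ≤ r → x ≤ p ╲ r
  ╲-intro {x} p&x≤r = ⋁-upper proj₁ (x , p&x≤r)

  ╲-elim : ∀ p r → p & (p ╲ r) ≤ r
  ╲-elim p r = &-⋁-least proj₁ p r proj₂

  ∧-greatest : ∀ {u p q} → u ≤ p → u ≤ q → u ≤ p ∧ q
  ∧-greatest {u} u≤p u≤q = ⋁-upper proj₁ (u , u≤p , u≤q)

  ∧-lowerˡ : ∀ p q → p ∧ q ≤ p
  ∧-lowerˡ p q = ⋁-least proj₁ p (λ i → proj₁ (proj₂ i))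

  ∧-lowerʳ : ∀ p q → p ∧ q ≤ q
  ∧-lowerʳ p q = ⋁-least proj₁ q (λ i → proj₂ (proj₂ i))

  /-factor : ∀ {x p u} → x & p ≡ u → (u / p) & p ≡ u
  /-factor {x} {p} {u} x&p≡u = ≤-antisym (/-elim u p) (begin
    u           ≡⟨ sym x&p≡u ⟩
    x & p       ≤⟨ &-monoˡ-≤ p (/-intro (≤-reflexive x&p≡u)) ⟩
    (u / p) & p ∎)

  ╲-factor : ∀ {y q u} → q & y ≡ u → q & (q ╲ u) ≡ u
  ╲-factor {y} {q} {u} q&y≡u = ≤-antisym (╲-elim q u) (begin
    u           ≡⟨ sym q&y≡u ⟩
    q & y       ≤⟨ &-monoʳ-≤ q (╲-intro (≤-reflexive q&y≡u)) ⟩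
    q & (q ╲ u) ∎)

  𝒟-intro : ∀ {x y p q u} → x & p ≡ u → q & y ≡ u → 𝒟 p q u
  𝒟-intro x&p≡u q&y≡u = /-factor x&p≡u , ╲-factor q&y≡u

  𝒟-⊥q : ∀ p q → 𝒟 p q ⊥q
  𝒟-⊥q p q = 𝒟-intro (&-zeroˡ p) (&-zeroʳ q)

  𝒟-e : ∀ u → 𝒟 e e u
  𝒟-e u = 𝒟-intro (&-identityʳ u) (&-identityˡ u)

  𝒟-refl : ∀ q → 𝒟 q q q
  𝒟-refl q = 𝒟-intro (&-identityˡ q) (&-identityʳ q)

  𝒟-⊥q-left : ∀ q u → 𝒟 ⊥q q u ⇔ u ≡ ⊥q
  𝒟-⊥q-left q u = mk⇔ (λ (u/⊥&⊥≡u , _) → trans (sym u/⊥&⊥≡u) (&-zeroʳ _))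
                      (λ { refl → 𝒟-⊥q ⊥q q })

  𝒟-⊥q-right : ∀ q u → 𝒟 q ⊥q u ⇔ u ≡ ⊥q
  𝒟-⊥q-right q u = mk⇔ (λ (_ , ⊥&⊥╲u≡u) → trans (sym ⊥&⊥╲u≡u) (&-zeroˡ _))
                       (λ { refl → 𝒟-⊥q q ⊥q })

  &-⊤q-&-⊤q : ∀ x → (x & ⊤q) & ⊤q ≤ x & ⊤q
  &-⊤q-&-⊤q x = begin
    (x & ⊤q) & ⊤q ≡⟨ &-assoc x ⊤q ⊤q ⟩
    x & (⊤q & ⊤q) ≤⟨ &-monoʳ-≤ x (⊤q-maximum (⊤q & ⊤q)) ⟩
    x & ⊤q        ∎

  𝒟-⊤q-e⇒integral : 𝒟 ⊤q ⊤q e → Integral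
  𝒟-⊤q-e⇒integral (e/⊤&⊤≡e , _) = ≤-antisym (⊤q-maximum e) (begin
    ⊤q                    ≡⟨ sym (&-identityˡ ⊤q) ⟩
    e & ⊤q                ≡⟨ cong (_& ⊤q) (sym e/⊤&⊤≡e) ⟩
    ((e / ⊤q) & ⊤q) & ⊤q  ≤⟨ &-⊤q-&-⊤q (e / ⊤q) ⟩
    (e / ⊤q) & ⊤q         ≡⟨ e/⊤&⊤≡e ⟩
    e                     ∎)

  integral⇒𝒟-⊤q-e : Integral → 𝒟 ⊤q ⊤q e
  integral⇒𝒟-⊤q-e e≡⊤ = subst (𝒟 ⊤q ⊤q) (sym e≡⊤) (𝒟-refl ⊤q)

  integral⇒&-lowerʳ : Integral → ∀ x p → x & p ≤ p
  integral⇒&-lowerʳ e≡⊤ x p = begin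
    x & p  ≤⟨ &-monoˡ-≤ p (⊤q-maximum x) ⟩
    ⊤q & p ≡⟨ cong (_& p) (sym e≡⊤) ⟩
    e & p  ≡⟨ &-identityˡ p ⟩
    p      ∎

  integral⇒&-lowerˡ : Integral → ∀ q y → q & y ≤ q
  integral⇒&-lowerˡ e≡⊤ q y = begin
    q & y  ≤⟨ &-monoʳ-≤ q (⊤q-maximum y) ⟩
    q & ⊤q ≡⟨ cong (q &_) (sym e≡⊤) ⟩
    q & e  ≡⟨ &-identityʳ q ⟩
    q      ∎

  integral⇒𝒟⊆∧ : Integral → ∀ p q u → 𝒟 p q u → u ≤ p ∧ q
  integral⇒𝒟⊆∧ e≡⊤ p q u (u/p&p≡u , q&q╲u≡u) = ∧-greatest
    (subst (_≤ p) u/p&p≡u (integral⇒&-lowerʳ e≡⊤ (u / p) p))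
    (subst (_≤ q) q&q╲u≡u (integral⇒&-lowerˡ e≡⊤ q (q ╲ u)))

  𝒟⊆∧⇒integral : (∀ p q u → 𝒟 p q u → u ≤ p ∧ q) → Integral
  𝒟⊆∧⇒integral 𝒟⊆∧ =
    ≤-antisym (⊤q-maximum e) (≤-trans (𝒟⊆∧ e e ⊤q (𝒟-e ⊤q)) (∧-lowerˡ e e))

  divisible⇒integral : Divisible → Integral
  divisible⇒integral divisible =
    𝒟-⊤q-e⇒integral (swap (divisible e ⊤q (⊤q-maximum e)))

  divisible⇒𝒟⇔∧ : Divisible → ∀ p q u → 𝒟 p q u ⇔ u ≤ p ∧ q
  divisible⇒𝒟⇔∧ divisible p q u =
    mk⇔ (integral⇒𝒟⊆∧ (divisible⇒integral divisible) p q u)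
        (λ u≤p∧q → proj₂ (divisible u p (≤-trans u≤p∧q (∧-lowerˡ p q)))
                 , proj₁ (divisible u q (≤-trans u≤p∧q (∧-lowerʳ p q))))

  𝒟⇔∧⇒divisible : (∀ p q u → 𝒟 p q u ⇔ u ≤ p ∧ q) → Divisible
  𝒟⇔∧⇒divisible 𝒟⇔∧ u q u≤q =
    swap (Equivalence.from (𝒟⇔∧ q q u) (∧-greatest u≤q u≤q))

-- Non-triviality (⊥ < e) is part of the setting but none of (1)–(7) needs it.
lemma2p1 : ∀ {c : Level} (Q : UnitalQuantale c) → NonTrivial Q →
    let open UnitalQuantale Q in
    ((p q : Carrier) →
      (∀ u → (𝒟 ⊥q q u ⇔ u ≡ ⊥q) × (𝒟 q ⊥q u ⇔ u ≡ ⊥q))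
      × (∀ u → 𝒟 e e u)
      × 𝒟 q q q
      × 𝒟 p q ⊥q)
    × (𝒟 ⊤q ⊤q e ⇔ Integral)
    × (Integral ⇔ (∀ p q u → 𝒟 p q u → u ≤ p ∧ q))
    × (Divisible ⇔ (∀ p q u → 𝒟 p q u ⇔ u ≤ p ∧ q))
lemma2p1 Q _ =
    (λ p q → (λ u → 𝒟-⊥q-left q u , 𝒟-⊥q-right q u) , 𝒟-e , 𝒟-refl q , 𝒟-⊥q p q)
  , mk⇔ 𝒟-⊤q-e⇒integral integral⇒𝒟-⊤q-e
  , mk⇔ integral⇒𝒟⊆∧ 𝒟⊆∧⇒integral
  , mk⇔ divisible⇒𝒟⇔∧ 𝒟⇔∧⇒divisible
  where open QuantaleProperties Q
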